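{- Let $k,n\in\mathbb{N}$ and $G=C_n(\{1,5,n-5,n-1\})$. If $n=12k$ or $n=14k$, then $\lambda_{(3,2,1)}(G)=13$; moreover, the labeling obtained by repeating the pattern $0,5,10,1,6,11,2,7,12,3,8,13$ (for $n=12k$), respectively the pattern $0,5,10,1,6,11,2,7,12,3,8,13,4,9$ (for $n=14k$), is an $L(3,2,1)$-labeling of $G$.
   Context: For $n\ge 3$ and $S\subseteq\{1,\dots,n-1\}$ closed under $x\mapsto n-x$, the circulant $C_n(S)$ is the graph with vertex set $\{u_1,\dots,u_n\}$ in which $u_iu_j$ is an edge iff $|i-j|\in S$. An $L(3,2,1)$-labeling of a graph $G$ is a function $f:V(G)\to\mathbb{N}\cup\{0\}$ such that $|f(x)-f(y)|>3-\operatorname{dist}_G(x,y)$ for all distinct $x,y\in V(G)$. $\lambda_{(3,2,1)}(G)$ is the minimum, over all $L(3,2,1)$-labelings of $G$, of the difference between the largest and smallest label used. Repeating a pattern $p_1,\dots,p_m$ (where $m$ divides $n$) means the labeling $f(u_i)=p_{((i-1)\bmod m)+1}$ for $i=1,\dots,n$. -}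

module Defs where

open import Data.Nat using (ℕ; zero; suc; _+_; _*_; _∸_; _<_; _≤_; _⊔_; _⊓_; ∣_-_∣; NonZero)
open import Data.Nat.DivMod using (_mod_)
open import Data.Fin using (Fin; toℕ) renaming (zero to fzero; suc to fsuc)
open import Data.Vec using (Vec; lookup; _∷_; [])
open import Data.Product using (Σ; _×_; _,_)
open import Data.Sum using (_⊎_)
open import Relation.Binary.PropositionalEquality using (_≡_; _≢_)

-- Vertex u_i (i = 1..n) is represented by  Fin n  element  i-1.
-- Circulant graph C_n(S): u_i ~ u_j  iff  |i - j| ∈ S.
CirculantAdj : (n : ℕ) → (S : ℕ → Set) → Fin n → Fin n → Set
CirculantAdj n S i j = S ∣ toℕ i - toℕ j ∣

S1-5 : ℕ → ℕ → Set
S1-5 n d = (d ≡ 1) ⊎ (d ≡ 5) ⊎ (d ≡ n ∸ 5) ⊎ (d ≡ n ∸ 1)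

data Walk {n : ℕ} (Adj : Fin n → Fin n → Set) : ℕ → Fin n → Fin n → Set where
  nil  : ∀ {x} → Walk Adj 0 x x
  cons : ∀ {d x y z} → Adj x y → Walk Adj d y z → Walk Adj (suc d) x z

-- L(3,2,1)-labeling: |f x - f y| > 3 - dist(x,y) for all distinct x, y.
-- Equivalently (with natural numbers): dist(x,y) + |f x - f y| > 3, and since
-- dist(x,y) is the minimal length of a walk from x to y, this is the same as
-- requiring  d + |f x - f y| > 3  for every walk of length d from x to y.
IsL321 : {n : ℕ} → (Fin n → Fin n → Set) → (Fin n → ℕ) → Set
IsL321 {n} Adj f =
  ∀ (x y : Fin n) → x ≢ y → ∀ (d : ℕ) → Walk Adj d x y → 3 < d + ∣ f x - f y ∣

maxLabel : {n : ℕ} → (Fin n → ℕ) → ℕ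
maxLabel {zero} f = 0
maxLabel {suc n} f = f fzero ⊔ maxLabel {n} (λ i → f (fsuc i))

minLabel : {n : ℕ} → (Fin n → ℕ) → ℕ
minLabel {zero} f = 0
minLabel {suc zero} f = f fzero
minLabel {suc (suc n)} f = f fzero ⊓ minLabel {suc n} (λ i → f (fsuc i))

span : {n : ℕ} → (Fin n → ℕ) → ℕ
span f = maxLabel f ∸ minLabel f

Lambda321≡ : {n : ℕ} → (Fin n → Fin n → Set) → ℕ → Set
Lambda321≡ {n} Adj m =
  (Σ (Fin n → ℕ) (λ f → IsL321 Adj f × span f ≡ m))
  × (∀ (f : Fin n → ℕ) → IsL321 Adj f → m ≤ span f)

-- Repeating the pattern p_1..p_m: f(u_i) = p_{((i-1) mod m)+1}; 0-based here.
repeatPattern : {m : ℕ} .{{_ : NonZero m}} → Vec ℕ m → (n : ℕ) → Fin n → ℕ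
repeatPattern {m} p n i = lookup p (toℕ i mod m)

pattern12 : Vec ℕ 12
pattern12 = 0 ∷ 5 ∷ 10 ∷ 1 ∷ 6 ∷ 11 ∷ 2 ∷ 7 ∷ 12 ∷ 3 ∷ 8 ∷ 13 ∷ []

pattern14 : Vec ℕ 14
pattern14 = 0 ∷ 5 ∷ 10 ∷ 1 ∷ 6 ∷ 11 ∷ 2 ∷ 7 ∷ 12 ∷ 3 ∷ 8 ∷ 13 ∷ 4 ∷ 9 ∷ []

{-# OPTIONS --safe #-}
module Submission where

-- A walk of length d in C_n({1,5,n−5,n−1}) is a word of d steps ±1, ±5 whose
-- displacement is the difference of its end points mod n (the position a ∈ ℕ
-- standing for the vertex a mod n).
-- Lower bound: the words 1, 5 | 1+1, 5−1, 5+1, 5+5 | 5−1−1, 5+1+1, 5+5−1, 5+5+1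
-- show that an L(3,2,1)-labelling separates labels at offsets 1, 5 by 3, at
-- 2, 4, 6, 10 by 2 and at 3, 7, 9, 11 by 1, the vertices being distinct once
-- n ≥ 12.  An exhaustive search shows that no h : ℕ → {0, …, 12} does this on
-- the positions 0, …, 30, so the span is at least 13.
-- Upper bound: if the pattern length m divides n, the displacement of a walk is
-- also the difference of its end points mod m, so the repeated pattern is an
-- L(3,2,1)-labelling as soon as it passes the check for all words of length at
-- most 3 and all pairs of residues mod m.

open import Data.Bool using (Bool; true; false; T)
open import Data.Bool.ListAction using (all)
open import Data.Bool.Properties using (T-≡)
open import Data.Empty using (⊥; ⊥-elim)
open import Data.Fin using (Fin; toℕ; zero; suc)
open import Data.Fin.Properties using (toℕ-injective; toℕ<n; toℕ-fromℕ<; all?)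
open import Data.List using (List; []; _∷_; length; filter; upTo; applyUpTo)
open import Data.List.Membership.Propositional.Properties using (∈-upTo⁺; ∈-filter⁺)
open import Data.List.Relation.Unary.All as All using (All; []; _∷_)
open import Data.List.Relation.Unary.All.Properties using (all⁺; all⁻)
open import Data.Nat
open import Data.Nat.DivMod
open import Data.Nat.Divisibility using (_∣_; ∣-refl; ∣⇒≤; n∣m*n; m∣m*n)
open import Data.Nat.Properties
open import Algebra.Properties.CommutativeSemigroup +-commutativeSemigroup
  using (x∙yz≈y∙xz; xy∙z≈y∙xz)
open import Data.Product using (∃-syntax; _×_; _,_)
open import Data.Sum using (_⊎_; inj₁; inj₂)
open import Data.Vec using (Vec; lookup)
open import Defs
open import Function using (_∘_; Equivalence)
open import Relation.Binary.PropositionalEquality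
open import Relation.Nullary using (Dec; yes; no; ¬_; ¬?; _×-dec_; _→-dec_; map′)
open import Relation.Nullary.Decidable using (T?; from-yes)

open ≡-Reasoning

f≤maxLabel : ∀ {n} (f : Fin n → ℕ) x → f x ≤ maxLabel f
f≤maxLabel f zero    = m≤m⊔n _ _
f≤maxLabel f (suc x) = ≤-trans (f≤maxLabel (f ∘ suc) x) (m≤n⊔m _ _)

maxLabel-least : ∀ {n b} (f : Fin n → ℕ) → (∀ x → f x ≤ b) → maxLabel f ≤ b
maxLabel-least {zero}  f _   = z≤n
maxLabel-least {suc n} f f≤b = ⊔-lub (f≤b zero) (maxLabel-least (f ∘ suc) (f≤b ∘ suc))

minLabel≤f : ∀ {n} (f : Fin n → ℕ) x → minLabel f ≤ f x
minLabel≤f {1}           f zero    = ≤-refl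
minLabel≤f {suc (suc n)} f zero    = m⊓n≤m _ _
minLabel≤f {suc (suc n)} f (suc x) = ≤-trans (m⊓n≤n _ _) (minLabel≤f (f ∘ suc) x)

span≡ : ∀ {n b} (f : Fin n → ℕ) → (∀ x → f x ≤ b) →
        ∀ {x₀ x₁} → f x₀ ≡ 0 → f x₁ ≡ b → span f ≡ b
span≡ {b = b} f f≤b {x₀} {x₁} fx₀≡0 fx₁≡b = cong₂ _∸_ max≡b min≡0
  where
  max≡b : maxLabel f ≡ b
  max≡b = ≤-antisym (maxLabel-least f f≤b) (subst (_≤ maxLabel f) fx₁≡b (f≤maxLabel f x₁))
  min≡0 : minLabel f ≡ 0
  min≡0 = n≤0⇒n≡0 (subst (minLabel f ≤_) fx₀≡0 (minLabel≤f f x₀))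

∣m-n∣≡o⇒n≡o+m⊎m≡o+n : ∀ m n {o} → ∣ m - n ∣ ≡ o → n ≡ o + m ⊎ m ≡ o + n
∣m-n∣≡o⇒n≡o+m⊎m≡o+n m n refl with ≤-total m n
... | inj₁ m≤n = inj₁ (trans (sym (m∸n+n≡m m≤n)) (cong (_+ m) (sym (m≤n⇒∣m-n∣≡n∸m m≤n))))
... | inj₂ n≤m = inj₂ (trans (sym (m∸n+n≡m n≤m)) (cong (_+ n) (sym (m≤n⇒∣n-m∣≡n∸m n≤m))))

3<d+x⇒4∸d≤x : ∀ d {x} → 3 < d + x → 4 ∸ d ≤ x
3<d+x⇒4∸d≤x d = m≤n+o⇒m∸n≤o 4 d

4∸d≤x⇒3<d+x : ∀ d {x} → 4 ∸ d ≤ x → 3 < d + x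
4∸d≤x⇒3<d+x d 4∸d≤x = ≤-trans (m≤n+m∸n 4 d) (+-monoʳ-≤ d 4∸d≤x)

∣m∸o-n∸o∣≡∣m-n∣ : ∀ {m n o} → o ≤ m → o ≤ n → ∣ m ∸ o - n ∸ o ∣ ≡ ∣ m - n ∣
∣m∸o-n∸o∣≡∣m-n∣ {m} {n} {o} o≤m o≤n = begin
  ∣ m ∸ o - n ∸ o ∣             ≡⟨ ∣m+n-m+o∣≡∣n-o∣ o (m ∸ o) (n ∸ o) ⟨
  ∣ o + (m ∸ o) - o + (n ∸ o) ∣ ≡⟨ cong₂ ∣_-_∣ (m+[n∸m]≡n o≤m) (m+[n∸m]≡n o≤n) ⟩
  ∣ m - n ∣                     ∎

∣o∸m-o∸n∣≡∣m-n∣ : ∀ {m n} o → m ≤ o → n ≤ o → ∣ o ∸ m - o ∸ n ∣ ≡ ∣ m - n ∣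
∣o∸m-o∸n∣≡∣m-n∣ {zero}  {n}     o       _         n≤o       =
  trans (m≤n⇒∣n-m∣≡n∸m (m∸n≤m o n)) (m∸[m∸n]≡n n≤o)
∣o∸m-o∸n∣≡∣m-n∣ {suc m} {zero}  o       m<o       _         =
  trans (∣-∣-comm (o ∸ suc m) o) (∣o∸m-o∸n∣≡∣m-n∣ o z≤n m<o)
∣o∸m-o∸n∣≡∣m-n∣ {suc m} {suc n} (suc o) (s≤s m≤o) (s≤s n≤o) = ∣o∸m-o∸n∣≡∣m-n∣ o m≤o n≤o

∣m-[n+m]%o∣≡n⊎o∸n : ∀ {m n o} .{{_ : NonZero o}} → m < o → n < o →
                    ∣ m - (n + m) % o ∣ ≡ n ⊎ ∣ m - (n + m) % o ∣ ≡ o ∸ n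
∣m-[n+m]%o∣≡n⊎o∸n {m} {n} {o} m<o n<o with n + m <? o
... | yes n+m<o = inj₁ (begin
  ∣ m - (n + m) % o ∣ ≡⟨ cong ∣ m -_∣ (trans (m<n⇒m%n≡m n+m<o) (+-comm n m)) ⟩
  ∣ m - m + n ∣       ≡⟨ ∣m-m+n∣≡n m n ⟩
  n                   ∎)
... | no n+m≮o = inj₂ (begin
  ∣ m - (n + m) % o ∣ ≡⟨ cong₂ ∣_-_∣ m≡t+[o∸n] [n+m]%o≡t ⟩
  ∣ t + (o ∸ n) - t ∣ ≡⟨ ∣-∣-comm (t + (o ∸ n)) t ⟩
  ∣ t - t + (o ∸ n) ∣ ≡⟨ ∣m-m+n∣≡n t (o ∸ n) ⟩
  o ∸ n               ∎)
  where
  o≤n+m : o ≤ n + m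
  o≤n+m = ≮⇒≥ n+m≮o
  t : ℕ
  t = n + m ∸ o
  t+o≡n+m : t + o ≡ n + m
  t+o≡n+m = m∸n+n≡m o≤n+m
  t<o : t < o
  t<o = +-cancelʳ-< o t o (subst (_< o + o) (sym t+o≡n+m) (+-mono-< n<o m<o))
  [n+m]%o≡t : (n + m) % o ≡ t
  [n+m]%o≡t = trans (sym (m≤n⇒[n∸m]%m≡n%m o≤n+m)) (m<n⇒m%n≡m t<o)
  m≡t+[o∸n] : m ≡ t + (o ∸ n)
  m≡t+[o∸n] = +-cancelʳ-≡ n m (t + (o ∸ n)) (begin
    m + n             ≡⟨ +-comm m n ⟩
    n + m             ≡⟨ t+o≡n+m ⟨
    t + o             ≡⟨ cong (t +_) (m∸n+n≡m (<⇒≤ n<o)) ⟨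
    t + (o ∸ n + n)   ≡⟨ +-assoc t (o ∸ n) n ⟨
    t + (o ∸ n) + n   ∎)

module Congruence (n : ℕ) .{{_ : NonZero n}} where

  infix 4 _≈_
  _≈_ : ℕ → ℕ → Set
  a ≈ b = a % n ≡ b % n

  ≈-+ˡ : ∀ c {a b} → a ≈ b → c + a ≈ c + b
  ≈-+ˡ c {a} {b} a≈b = begin
    (c + a) % n         ≡⟨ %-distribˡ-+ c a n ⟩
    (c % n + a % n) % n ≡⟨ cong (λ r → (c % n + r) % n) a≈b ⟩
    (c % n + b % n) % n ≡⟨ %-distribˡ-+ c b n ⟨
    (c + b) % n         ∎

  ≈-wrap : ∀ {d} c → d ≤ n → d + (n ∸ d + c) ≈ c
  ≈-wrap {d} c d≤n = begin
    (d + (n ∸ d + c)) % n ≡⟨ cong (_% n) (+-assoc d (n ∸ d) c) ⟨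
    (d + (n ∸ d) + c) % n ≡⟨ cong (λ k → (k + c) % n) (m+[n∸m]≡n d≤n) ⟩
    (n + c) % n           ≡⟨ %-remove-+ˡ c ∣-refl ⟩
    c % n                 ∎

  -- Adding c * n − c to both sides turns c + a into c * n + a.
  ≈-cancel-+ˡ : ∀ c {a b} → c + a ≈ c + b → a ≈ b
  ≈-cancel-+ˡ c {a} {b} c+a≈c+b = begin
    a % n                       ≡⟨ %-remove-+ˡ a (n∣m*n c) ⟨
    (c * n + a) % n             ≡⟨ cong (_% n) (shift a) ⟩
    (c * n ∸ c + (c + a)) % n   ≡⟨ ≈-+ˡ (c * n ∸ c) c+a≈c+b ⟩
    (c * n ∸ c + (c + b)) % n   ≡⟨ cong (_% n) (shift b) ⟨
    (c * n + b) % n             ≡⟨ %-remove-+ˡ b (n∣m*n c) ⟩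
    b % n                       ∎
    where
    shift : ∀ x → c * n + x ≡ c * n ∸ c + (c + x)
    shift x = trans (cong (_+ x) (sym (m∸n+n≡m (m≤m*n c n)))) (+-assoc (c * n ∸ c) c x)

  ≈-compose : ∀ u v U V {x y z} → u + x ≈ v + z → U + z ≈ V + y → u + U + x ≈ v + V + y
  ≈-compose u v U V {x} {y} {z} e₁ e₂ = begin
    (u + U + x) % n   ≡⟨ cong (_% n) (xy∙z≈y∙xz u U x) ⟩
    (U + (u + x)) % n ≡⟨ ≈-+ˡ U e₁ ⟩
    (U + (v + z)) % n ≡⟨ cong (_% n) (x∙yz≈y∙xz U v z) ⟩
    (v + (U + z)) % n ≡⟨ ≈-+ˡ v e₂ ⟩
    (v + (V + y)) % n ≡⟨ cong (_% n) (+-assoc v V y) ⟨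
    (v + V + y) % n   ∎

  ≈-split : ∀ u v U V {x y z} → u + x ≈ v + z → u + U + x ≈ v + V + y → U + z ≈ V + y
  ≈-split u v U V {x} {y} {z} e₁ e = ≈-cancel-+ˡ v (begin
    (v + (U + z)) % n ≡⟨ cong (_% n) (x∙yz≈y∙xz v U z) ⟩
    (U + (v + z)) % n ≡⟨ ≈-+ˡ U e₁ ⟨
    (U + (u + x)) % n ≡⟨ cong (_% n) (xy∙z≈y∙xz u U x) ⟨
    (u + U + x) % n   ≡⟨ e ⟩
    (v + V + y) % n   ≡⟨ cong (_% n) (+-assoc v V y) ⟩
    (v + (V + y)) % n ∎)

  ≈⇒≡-mod : ∀ {m a b} .{{_ : NonZero m}} → m ∣ n → a ≈ b → a % m ≡ b % m
  ≈⇒≡-mod {m} {a} {b} m∣n a≈b = begin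
    a % m     ≡⟨ m∣n⇒o%n%m≡o%m m n a m∣n ⟨
    a % n % m ≡⟨ cong (_% m) a≈b ⟩
    b % n % m ≡⟨ m∣n⇒o%n%m≡o%m m n b m∣n ⟩
    b % m     ∎

-- Walks are words

data Step : Set where
  ↑1 ↑5 ↓1 ↓5 : Step

up down : Step → ℕ
up ↑1 = 1
up ↑5 = 5
up ↓1 = 0
up ↓5 = 0
down ↑1 = 0
down ↑5 = 0
down ↓1 = 1
down ↓5 = 5

Word : Set
Word = List Step

-- w leads from position a to position b iff pos w + a ≡ neg w + b (mod n).
pos neg : Word → ℕ
pos []      = 0
pos (s ∷ w) = up s + pos w
neg []      = 0
neg (s ∷ w) = down s + neg w

∀-step? : {P : Step → Set} → (∀ s → Dec (P s)) → Dec (∀ s → P s)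
∀-step? P? = map′ (λ { (p₁ , p₅ , q₁ , q₅) → λ { ↑1 → p₁ ; ↑5 → p₅ ; ↓1 → q₁ ; ↓5 → q₅ } })
                  (λ p → p ↑1 , p ↑5 , p ↓1 , p ↓5)
                  (P? ↑1 ×-dec P? ↑5 ×-dec P? ↓1 ×-dec P? ↓5)

∀-word≤? : ∀ k {P : Word → Set} → (∀ w → Dec (P w)) → Dec (∀ w → length w ≤ k → P w)
∀-word≤? zero    P? = map′ (λ { p [] _ → p ; p (_ ∷ _) () }) (λ p → p [] z≤n) (P? [])
∀-word≤? (suc k) P? =
  map′ (λ { (p , _) [] _ → p ; (_ , q) (s ∷ w) (s≤s l) → q s w l })
       (λ p → p [] z≤n , λ s w l → p (s ∷ w) (s≤s l))
       (P? [] ×-dec ∀-step? (λ s → ∀-word≤? k (P? ∘ (s ∷_))))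

module Circulant (n : ℕ) .{{_ : NonZero n}} (5<n : 5 < n) where

  open Congruence n public

  G : Fin n → Fin n → Set
  G = CirculantAdj n (S1-5 n)

  1<n : 1 < n
  1<n = ≤-trans (s≤s (s≤s z≤n)) 5<n

  vtx : ℕ → Fin n
  vtx a = a mod n

  toℕ-vtx : ∀ a → toℕ (vtx a) ≡ a % n
  toℕ-vtx a = toℕ-fromℕ< (m%n<n a n)

  vtx-cong : ∀ {a b} → a ≈ b → vtx a ≡ vtx b
  vtx-cong {a} {b} a≈b = toℕ-injective (trans (toℕ-vtx a) (trans a≈b (sym (toℕ-vtx b))))

  toℕ-≈⇒≡ : ∀ {x y : Fin n} → toℕ x ≈ toℕ y → x ≡ y
  toℕ-≈⇒≡ {x} {y} e =
    toℕ-injective (trans (sym (m<n⇒m%n≡m (toℕ<n x))) (trans e (m<n⇒m%n≡m (toℕ<n y))))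

  vtx≢vtx-+ : ∀ {o} a → 0 < o → o < n → vtx a ≢ vtx (o + a)
  vtx≢vtx-+ {o} a 0<o o<n vtx≡ = <⇒≢ 0<o (begin
    0         ≡⟨ m<n⇒m%n≡m (>-nonZero⁻¹ n) ⟨
    0 % n     ≡⟨ ≈-cancel-+ˡ a (subst₂ _≈_ (sym (+-identityʳ a)) (+-comm o a) a≈o+a) ⟩
    o % n     ≡⟨ m<n⇒m%n≡m o<n ⟩
    o         ∎)
    where
    a≈o+a : a ≈ o + a
    a≈o+a = trans (sym (toℕ-vtx a)) (trans (cong toℕ vtx≡) (toℕ-vtx (o + a)))

  G-sym : ∀ {x y} → G x y → G y x
  G-sym {x} {y} = subst (S1-5 n) (∣-∣-comm (toℕ x) (toℕ y))

  G-+ : ∀ {s} a → s < n → S1-5 n s → S1-5 n (n ∸ s) → G (vtx a) (vtx (s + a))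
  G-+ {s} a s<n S-s S-n∸s =
    subst (S1-5 n) (sym distance) (dist∈S (∣m-[n+m]%o∣≡n⊎o∸n (m%n<n a n) s<n))
    where
    distance : ∣ toℕ (vtx a) - toℕ (vtx (s + a)) ∣ ≡ ∣ a % n - (s + a % n) % n ∣
    distance = cong₂ ∣_-_∣ (toℕ-vtx a) (trans (toℕ-vtx (s + a)) (≈-+ˡ s (sym (m%n%n≡m%n a n))))
    dist∈S : ∀ {d} → d ≡ s ⊎ d ≡ n ∸ s → S1-5 n d
    dist∈S (inj₁ refl) = S-s
    dist∈S (inj₂ refl) = S-n∸s

  G-+1 : ∀ a → G (vtx a) (vtx (1 + a))
  G-+1 a = G-+ a 1<n (inj₁ refl) (inj₂ (inj₂ (inj₂ refl)))

  G-+5 : ∀ a → G (vtx a) (vtx (5 + a))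
  G-+5 a = G-+ a 5<n (inj₂ (inj₁ refl)) (inj₂ (inj₂ (inj₁ refl)))

  step-edge : ∀ s {a b} → up s + a ≈ down s + b → G (vtx a) (vtx b)
  step-edge ↑1 {a} {b} e = subst (G (vtx a)) (vtx-cong {1 + a} {b} e) (G-+1 a)
  step-edge ↑5 {a} {b} e = subst (G (vtx a)) (vtx-cong {5 + a} {b} e) (G-+5 a)
  step-edge ↓1 {a} {b} e = G-sym {vtx b} (subst (G (vtx b)) (vtx-cong {1 + b} {a} (sym e)) (G-+1 b))
  step-edge ↓5 {a} {b} e = G-sym {vtx b} (subst (G (vtx b)) (vtx-cong {5 + b} {a} (sym e)) (G-+5 b))

  down≤n : ∀ s → down s ≤ n
  down≤n ↑1 = z≤n
  down≤n ↑5 = z≤n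
  down≤n ↓1 = <⇒≤ 1<n
  down≤n ↓5 = <⇒≤ 5<n

  distance-step : ∀ a b → S1-5 n ∣ a - b ∣ → ∃[ s ] up s + a ≈ down s + b
  distance-step a b (inj₁ d≡1) with ∣m-n∣≡o⇒n≡o+m⊎m≡o+n a b d≡1
  ... | inj₁ b≡1+a = ↑1 , cong (_% n) (sym b≡1+a)
  ... | inj₂ a≡1+b = ↓1 , cong (_% n) a≡1+b
  distance-step a b (inj₂ (inj₁ d≡5)) with ∣m-n∣≡o⇒n≡o+m⊎m≡o+n a b d≡5
  ... | inj₁ b≡5+a = ↑5 , cong (_% n) (sym b≡5+a)
  ... | inj₂ a≡5+b = ↓5 , cong (_% n) a≡5+b
  distance-step a b (inj₂ (inj₂ (inj₁ d≡n∸5))) with ∣m-n∣≡o⇒n≡o+m⊎m≡o+n a b d≡n∸5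
  ... | inj₁ refl = ↓5 , sym (≈-wrap a (down≤n ↓5))
  ... | inj₂ refl = ↑5 , ≈-wrap b (down≤n ↓5)
  distance-step a b (inj₂ (inj₂ (inj₂ d≡n∸1))) with ∣m-n∣≡o⇒n≡o+m⊎m≡o+n a b d≡n∸1
  ... | inj₁ refl = ↓1 , sym (≈-wrap a (down≤n ↓1))
  ... | inj₂ refl = ↑1 , ≈-wrap b (down≤n ↓1)

  walk→word : ∀ {d x y} → Walk G d x y → ∃[ w ] length w ≡ d × pos w + toℕ x ≈ neg w + toℕ y
  walk→word nil = [] , refl , refl
  walk→word {x = x} (cons {y = z} xz walk) with distance-step (toℕ x) (toℕ z) xz | walk→word walk
  ... | s , e | w , refl , e′ = s ∷ w , refl , ≈-compose (up s) (down s) (pos w) (neg w) e e′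

  -- The intermediate position a + up s − down s, kept in ℕ by adding n.
  word→walk : ∀ w {a b} → pos w + a ≈ neg w + b → Walk G (length w) (vtx a) (vtx b)
  word→walk []      {a} {b} e = subst (Walk G 0 (vtx a)) (vtx-cong {a} {b} e) nil
  word→walk (s ∷ w) {a}     e =
    cons (step-edge s step) (word→walk w (≈-split (up s) (down s) (pos w) (neg w) step e))
    where
    step : up s + a ≈ down s + (n ∸ down s + (up s + a))
    step = sym (≈-wrap (up s + a) (down≤n s))

-- Lower bound

-- The separation that the words in offset-gap force at offset o.
gap : ℕ → ℕ
gap 1  = 3
gap 5  = 3
gap 2  = 2
gap 4  = 2
gap 6  = 2
gap 10 = 2
gap 3  = 1
gap 7  = 1
gap 9  = 1
gap 11 = 1
gap _  = 0

Separated : (ℕ → ℕ) → Set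
Separated h = ∀ p q → gap ∣ p - q ∣ ≤ ∣ h p - h q ∣

separated-if-ordered : ∀ {h} → (∀ {p q} → p ≤ q → gap ∣ p - q ∣ ≤ ∣ h p - h q ∣) → Separated h
separated-if-ordered {h} ordered p q with ≤-total p q
... | inj₁ p≤q = ordered p≤q
... | inj₂ q≤p = subst₂ (λ o d → gap o ≤ d) (∣-∣-comm q p) (∣-∣-comm (h q) (h p)) (ordered q≤p)

separated-reflect : ∀ {h b} → Separated h → (∀ p → h p ≤ b) → Separated (λ p → b ∸ h p)
separated-reflect {h} {b} sep h≤b p q =
  subst (gap ∣ p - q ∣ ≤_) (sym (∣o∸m-o∸n∣≡∣m-n∣ b (h≤b p) (h≤b q))) (sep p q)

separated-shift : ∀ {h c} → (∀ p → c ≤ h p) → Separated h → Separated (λ p → h p ∸ c)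
separated-shift c≤h sep p q =
  subst (gap ∣ p - q ∣ ≤_) (sym (∣m∸o-n∸o∣≡∣m-n∣ (c≤h p) (c≤h q))) (sep p q)

Assignment : Set
Assignment = List (ℕ × ℕ)

compatible : ℕ → ℕ → Assignment → Bool
compatible p c = all λ (q , c′) → gap ∣ p - q ∣ ≤ᵇ ∣ c - c′ ∣

refutes : List ℕ → Assignment → Bool
refutes []       _   = false
refutes (p ∷ ps) asg =
  all (λ c → refutes ps ((p , c) ∷ asg)) (filter (λ c → T? (compatible p c asg)) (upTo 13))

Extends : (ℕ → ℕ) → Assignment → Set
Extends h = All λ (q , c) → h q ≡ c

module _ {h : ℕ → ℕ} (sep : Separated h) (h≤12 : ∀ p → h p ≤ 12) where

  compatible-extends : ∀ p {asg} → Extends h asg → T (compatible p (h p) asg)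
  compatible-extends p = all⁻ _ ∘ All.map λ {(q , c)} hq≡c →
    subst (λ c → T (gap ∣ p - q ∣ ≤ᵇ ∣ h p - c ∣)) hq≡c (≤⇒≤ᵇ (sep p q))

  refutes-sound : ∀ ps {asg} → Extends h asg → ¬ T (refutes ps asg)
  refutes-sound []       _   ()
  refutes-sound (p ∷ ps) {asg} ext t = refutes-sound ps (refl ∷ ext)
    (All.lookup (all⁺ (λ c → refutes ps ((p , c) ∷ asg)) _ t)
      (∈-filter⁺ (λ c → T? (compatible p c asg)) (∈-upTo⁺ (s≤s (h≤12 p)))
        (compatible-extends p ext)))

  refutes-below-sound : ∀ ps {p b} → h p < b →
                        all (λ c → refutes ps ((p , c) ∷ [])) (upTo b) ≡ true → ⊥
  refutes-below-sound ps {p} {b} hp<b t = refutes-sound ps {(p , h p) ∷ []} (refl ∷ [])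
    (All.lookup (all⁺ (λ c → refutes ps ((p , c) ∷ [])) (upTo b) (Equivalence.from T-≡ t))
      (∈-upTo⁺ hp<b))

-- Position 6 is decided first, with a label of at most 6 by the symmetry
-- separated-reflect; the other positions 0 … 30 follow in an order that lets
-- the search prune early.
laterPositions : List ℕ
laterPositions = 1 ∷ 2 ∷ 7 ∷ 11 ∷ 12 ∷ 5 ∷ 0 ∷ 10 ∷ 8 ∷ 4 ∷ 9 ∷ 3 ∷ applyUpTo (13 +_) 18

-- Stated with ≡ true: Agda checks this refl far faster than tt : T (…).
search-succeeds : all (λ c → refutes laterPositions ((6 , c) ∷ [])) (upTo 7) ≡ true
search-succeeds = refl

-- The implicit arguments are given so that the type of search-succeeds is
-- matched syntactically; unification would evaluate the search again.
separated⇒6<h6 : ∀ {h} → Separated h → (∀ p → h p ≤ 12) → 6 < h 6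
separated⇒6<h6 sep h≤12 = ≰⇒> λ h6≤6 →
  refutes-below-sound sep h≤12 laterPositions {6} {7} (s≤s h6≤6) search-succeeds

¬separated≤12 : ∀ {h} → Separated h → ¬ (∀ p → h p ≤ 12)
¬separated≤12 {h} sep h≤12 =
  <⇒≱ (separated⇒6<h6 (separated-reflect sep h≤12) (λ p → m∸n≤m 12 (h p)))
      (≤-trans (∸-monoʳ-≤ 12 (separated⇒6<h6 sep h≤12)) (n≤1+n 5))

module _ {n} .{{_ : NonZero n}} (12≤n : 12 ≤ n) where

  open Circulant n (≤-trans (≤ᵇ⇒≤ 6 12 _) 12≤n)

  offset-gap : ∀ {f} → IsL321 G f → ∀ p o → gap o ≤ ∣ f (vtx p) - f (vtx (o + p)) ∣
  offset-gap {f} L p = table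
    where
    along : ∀ o .{{_ : NonZero o}} {o<12 : T (o <ᵇ 12)} w → pos w ≡ o + neg w →
            4 ∸ length w ≤ ∣ f (vtx p) - f (vtx (o + p)) ∣
    along o {o<12} w e = 3<d+x⇒4∸d≤x (length w) (L (vtx p) (vtx (o + p))
      (vtx≢vtx-+ p (>-nonZero⁻¹ o) (≤-trans (<ᵇ⇒< o 12 o<12) 12≤n)) (length w)
      (word→walk w (cong (_% n) (trans (cong (_+ p) e) (xy∙z≈y∙xz o (neg w) p)))))
    table : ∀ o → gap o ≤ ∣ f (vtx p) - f (vtx (o + p)) ∣
    table 0  = z≤n
    table 1  = along 1  (↑1 ∷ []) refl
    table 2  = along 2  (↑1 ∷ ↑1 ∷ []) refl
    table 3  = along 3  (↑5 ∷ ↓1 ∷ ↓1 ∷ []) refl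
    table 4  = along 4  (↑5 ∷ ↓1 ∷ []) refl
    table 5  = along 5  (↑5 ∷ []) refl
    table 6  = along 6  (↑5 ∷ ↑1 ∷ []) refl
    table 7  = along 7  (↑5 ∷ ↑1 ∷ ↑1 ∷ []) refl
    table 8  = z≤n
    table 9  = along 9  (↑5 ∷ ↑5 ∷ ↓1 ∷ []) refl
    table 10 = along 10 (↑5 ∷ ↑5 ∷ []) refl
    table 11 = along 11 (↑5 ∷ ↑5 ∷ ↑1 ∷ []) refl
    table (suc (suc (suc (suc (suc (suc (suc (suc (suc (suc (suc (suc _)))))))))))) = z≤n

  span-lower-bound : ∀ {f} → IsL321 G f → 13 ≤ span f
  span-lower-bound {f} L = ≮⇒≥ λ span<13 →
    ¬separated≤12 (separated-shift (minLabel≤f f ∘ vtx) (separated-if-ordered {f ∘ vtx} ordered))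
      (λ p → ≤-trans (∸-monoˡ-≤ (minLabel f) (f≤maxLabel f (vtx p))) (s≤s⁻¹ span<13))
    where
    ordered : ∀ {p q} → p ≤ q → gap ∣ p - q ∣ ≤ ∣ f (vtx p) - f (vtx q) ∣
    ordered {p} {q} p≤q = subst₂ (λ o r → gap o ≤ ∣ f (vtx p) - f (vtx r) ∣)
      (sym (m≤n⇒∣m-n∣≡n∸m p≤q)) (m∸n+n≡m p≤q) (offset-gap {f} L p (q ∸ p))

-- Upper bound

module _ {m} .{{_ : NonZero m}} where

  RespectsShortWords : Vec ℕ m → Set
  RespectsShortWords P = ∀ w → length w ≤ 3 → pos w ≢ neg w → ∀ i j →
    (pos w + toℕ i) % m ≡ (neg w + toℕ j) % m → 4 ∸ length w ≤ ∣ lookup P i - lookup P j ∣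

  respectsShortWords? : ∀ P → Dec (RespectsShortWords P)
  respectsShortWords? P = ∀-word≤? 3 λ w → ¬? (pos w ≟ neg w) →-dec all? λ i → all? λ j →
    ((pos w + toℕ i) % m ≟ (neg w + toℕ j) % m) →-dec (4 ∸ length w ≤? ∣ lookup P i - lookup P j ∣)

module _ {m} .{{_ : NonZero m}} (P : Vec ℕ m)
         {n} .{{_ : NonZero n}} (m∣n : m ∣ n) (5<n : 5 < n) where

  open Circulant n 5<n

  repeatPattern-vtx : ∀ a → repeatPattern P n (vtx a) ≡ lookup P (a mod m)
  repeatPattern-vtx a = cong (lookup P) (toℕ-injective (begin
    toℕ (toℕ (vtx a) mod m) ≡⟨ toℕ-fromℕ< _ ⟩
    toℕ (vtx a) % m         ≡⟨ cong (_% m) (toℕ-vtx a) ⟩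
    a % n % m               ≡⟨ m∣n⇒o%n%m≡o%m m n a m∣n ⟩
    a % m                   ≡⟨ toℕ-fromℕ< _ ⟨
    toℕ (a mod m)           ∎))

  repeatPattern-isL321 : RespectsShortWords P → IsL321 G (repeatPattern P n)
  repeatPattern-isL321 respects x y x≢y d walk with walk→word walk
  ... | w , refl , e = 4∸d≤x⇒3<d+x (length w) (separation (pos w ≟ neg w) (length w ≤? 3))
    where
    residue : ∀ c (z : Fin n) → (c + toℕ (toℕ z mod m)) % m ≡ (c + toℕ z) % m
    residue c z = Congruence.≈-+ˡ m c (trans (cong (_% m) (toℕ-fromℕ< _)) (m%n%n≡m%n (toℕ z) m))
    separation : Dec (pos w ≡ neg w) → Dec (length w ≤ 3) →
                 4 ∸ length w ≤ ∣ repeatPattern P n x - repeatPattern P n y ∣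
    separation (yes pos≡neg) _ = ⊥-elim (x≢y (toℕ-≈⇒≡ (≈-cancel-+ˡ (pos w)
      (subst (λ k → pos w + toℕ x ≈ k + toℕ y) (sym pos≡neg) e))))
    separation (no pos≢neg) (yes short) = respects w short pos≢neg _ _
      (trans (residue (pos w) x) (trans (≈⇒≡-mod m∣n e) (sym (residue (neg w) y))))
    separation (no _) (no long) =
      subst (_≤ ∣ repeatPattern P n x - repeatPattern P n y ∣) (sym (m≤n⇒m∸n≡0 (≰⇒> long))) z≤n

  span-repeatPattern : ∀ {b} a₀ a₁ → (∀ i → lookup P i ≤ b) →
                       lookup P (a₀ mod m) ≡ 0 → lookup P (a₁ mod m) ≡ b →
                       span (repeatPattern P n) ≡ b
  span-repeatPattern a₀ a₁ P≤b P₀ P₁ = span≡ (repeatPattern P n) (λ _ → P≤b _)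
    (trans (repeatPattern-vtx a₀) P₀) (trans (repeatPattern-vtx a₁) P₁)

repeatPattern-optimal : ∀ {m} .{{_ : NonZero m}} (P : Vec ℕ m) {n} .{{_ : NonZero n}} →
  m ∣ n → 12 ≤ m → RespectsShortWords P → (∀ i → lookup P i ≤ 13) →
  ∀ a₀ a₁ → lookup P (a₀ mod m) ≡ 0 → lookup P (a₁ mod m) ≡ 13 →
  Lambda321≡ (CirculantAdj n (S1-5 n)) 13 × IsL321 (CirculantAdj n (S1-5 n)) (repeatPattern P n)
repeatPattern-optimal P {n} m∣n 12≤m respects P≤13 a₀ a₁ P₀ P₁ =
  ((repeatPattern P n , isL321 , span-repeatPattern P m∣n 5<n a₀ a₁ P≤13 P₀ P₁) ,
   λ _ → span-lower-bound 12≤n) , isL321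
  where
  12≤n : 12 ≤ n
  12≤n = ≤-trans 12≤m (∣⇒≤ m∣n)
  5<n : 5 < n
  5<n = ≤-trans (≤ᵇ⇒≤ 6 12 _) 12≤n
  isL321 : IsL321 (CirculantAdj n (S1-5 n)) (repeatPattern P n)
  isL321 = repeatPattern-isL321 P m∣n 5<n respects

mainTheorem11 : (k n : ℕ) → 1 ≤ k →
    ((n ≡ 12 * k →
        Lambda321≡ (CirculantAdj n (S1-5 n)) 13
        × IsL321 (CirculantAdj n (S1-5 n)) (repeatPattern pattern12 n))
    × (n ≡ 14 * k →
        Lambda321≡ (CirculantAdj n (S1-5 n)) 13
        × IsL321 (CirculantAdj n (S1-5 n)) (repeatPattern pattern14 n)))
mainTheorem11 (suc k) n (s≤s z≤n) =
    (λ { refl → repeatPattern-optimal pattern12 (m∣m*n (suc k)) ≤-refl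
                  (from-yes (respectsShortWords? pattern12))
                  (from-yes (all? λ i → lookup pattern12 i ≤? 13)) 0 11 refl refl })
  , (λ { refl → repeatPattern-optimal pattern14 (m∣m*n (suc k)) (≤ᵇ⇒≤ 12 14 _)
                  (from-yes (respectsShortWords? pattern14))
                  (from-yes (all? λ i → lookup pattern14 i ≤? 13)) 0 11 refl refl })
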